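{- Let $T$ be a tree with vertex set $\{v_1,\ldots,v_n\}$ and let $T^e$ be an arbitrary orientation of $T$. Let $(P_2\times T)^e$ be the orientation of $P_2\times T$ obtained as follows: take two copies $T_1$ (vertices $v_1',\ldots,v_n'$) and $T_2$ (vertices $v_1'',\ldots,v_n''$) of $T$, orient $T_1$ as $T^e$ and $T_2$ as the converse of $T^e$ (every arc reversed), and for each $i$ add the arc $v_i'\to v_i''$. Then $(P_2\times T)^e$ is a Pfaffian orientation of $P_2\times T$, and every cycle of even length of $P_2\times T$ is oddly oriented in $(P_2\times T)^e$.
   Context: All graphs are finite and simple. $P_2$ is the path with 2 vertices and $G\times H$ is the Cartesian product of graphs. A cycle $C$ of a graph $G$ is nice if $G-C$ (the subgraph induced by the vertices not on $C$) has a perfect matching. If $D$ is an orientation of $G$ and $C$ is a cycle of even length, $C$ is oddly oriented in $D$ if, for either direction of traversal of $C$, an odd number of edges of $C$ are directed in $D$ along that direction. An orientation $D$ of $G$ is a Pfaffian orientation if every nice cycle of even length of $G$ is oddly oriented in $D$. -}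

module Defs where

open import Data.Nat using (ℕ; zero; suc; _+_; _*_; _≤_; _%_)
open import Data.Nat.DivMod using (m%n<n)
open import Data.Bool using (Bool; true; false; if_then_else_; _xor_)
open import Data.Fin using (Fin; toℕ; fromℕ<; fromℕ; inject₁)
open import Data.Product using (Σ; ∃; _×_; _,_)
open import Data.Sum using (_⊎_)
open import Relation.Binary.PropositionalEquality using (_≡_; _≢_)
open import Relation.Nullary using (¬_)
open import Function.Definitions using (Injective)

Even : ℕ → Set
Even k = ∃ λ m → k ≡ 2 * m

Odd : ℕ → Set
Odd k = ∃ λ m → k ≡ suc (2 * m)

sumFin : ∀ {k} → (Fin k → ℕ) → ℕ
sumFin {zero}  f = 0
sumFin {suc k} f = f Fin.zero + sumFin (λ i → f (Fin.suc i))

record Graph (V : Set) : Set where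
  field
    adj   : V → V → Bool
    sym   : ∀ u v → adj u v ≡ adj v u
    irrfl : ∀ v → adj v v ≡ false
open Graph public

cnext : ∀ {k} → Fin k → Fin k
cnext {suc m} i = fromℕ< (m%n<n (suc (toℕ i)) (suc m))

record Cycle {V : Set} (G : Graph V) : Set where
  field
    len    : ℕ
    len≥3  : 3 ≤ len
    vx     : Fin len → V
    vx-inj : Injective _≡_ _≡_ vx
    vx-adj : ∀ i → adj G (vx i) (vx (cnext i)) ≡ true
open Cycle public

Walk : {V : Set} → Graph V → V → V → Set
Walk {V} G u v = Σ ℕ λ k → Σ (Fin (suc k) → V) λ w →
  (w Fin.zero ≡ u) × (w (fromℕ k) ≡ v) ×
  (∀ (i : Fin k) → adj G (w (inject₁ i)) (w (Fin.suc i)) ≡ true)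

Connected : {V : Set} → Graph V → Set
Connected G = ∀ u v → Walk G u v

IsTree : {V : Set} → Graph V → Set
IsTree G = Connected G × ¬ Cycle G

-- Orientations: arc u v = true means the edge uv is directed u → v

IsOrientation : {V : Set} → Graph V → (V → V → Bool) → Set
IsOrientation G arc =
  (∀ u v → arc u v ≡ true → adj G u v ≡ true) ×
  (∀ u v → adj G u v ≡ true → (arc u v xor arc v u) ≡ true)

b2n : Bool → ℕ
b2n true  = 1
b2n false = 0

forwardCount : {V : Set} {G : Graph V} → (V → V → Bool) → Cycle G → ℕ
forwardCount arc C = sumFin λ i → b2n (arc (vx C i) (vx C (cnext i)))

backwardCount : {V : Set} {G : Graph V} → (V → V → Bool) → Cycle G → ℕ
backwardCount arc C = sumFin λ i → b2n (arc (vx C (cnext i)) (vx C i))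

OddlyOriented : {V : Set} {G : Graph V} → (V → V → Bool) → Cycle G → Set
OddlyOriented arc C = Odd (forwardCount arc C) × Odd (backwardCount arc C)

OffCycle : {V : Set} {G : Graph V} → Cycle G → V → Set
OffCycle C v = ∀ i → vx C i ≢ v

-- G - C has a perfect matching (m pairs each off-cycle vertex with an
-- adjacent off-cycle vertex, and is an involution there)
Nice : {V : Set} (G : Graph V) → Cycle G → Set
Nice {V} G C = Σ (V → V) λ m → ∀ v → OffCycle C v →
  OffCycle C (m v) × (adj G v (m v) ≡ true) × (m (m v) ≡ v)

IsPfaffian : {V : Set} (G : Graph V) → (V → V → Bool) → Set
IsPfaffian G arc = IsOrientation G arc ×
  (∀ (C : Cycle G) → Even (len C) → Nice G C → OddlyOriented arc C)

-- P₂ × T  (vertices: false = copy T₁, true = copy T₂)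

beq : Bool → Bool → Bool
beq false false = true
beq true  true  = true
beq _     _     = false

module _ {n : ℕ} where
  open import Data.Fin using (_≟_)
  open import Relation.Nullary using (yes; no)

  feq : Fin n → Fin n → Bool
  feq u v with u ≟ v
  ... | yes _ = true
  ... | no  _ = false

P2×adj : ∀ {n} → (Fin n → Fin n → Bool) → Bool × Fin n → Bool × Fin n → Bool
P2×adj a (x , u) (y , v) = if beq x y then a u v else feq u v

P2×arc : ∀ {n} → (Fin n → Fin n → Bool) → Bool × Fin n → Bool × Fin n → Bool
P2×arc arc (false , u) (false , v) = arc u v
P2×arc arc (true  , u) (true  , v) = arc v u
P2×arc arc (false , u) (true  , v) = feq u v
P2×arc arc (true  , u) (false , v) = false

private
  open import Relation.Binary.PropositionalEquality using (refl; cong₂)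
  open import Data.Fin using (_≟_)
  open import Relation.Nullary using (yes; no)
  open import Relation.Binary.PropositionalEquality using () renaming (sym to ≡sym)

  beq-sym : ∀ x y → beq x y ≡ beq y x
  beq-sym false false = refl
  beq-sym false true  = refl
  beq-sym true  false = refl
  beq-sym true  true  = refl

  feq-sym : ∀ {n} (u v : Fin n) → feq u v ≡ feq v u
  feq-sym u v with u ≟ v | v ≟ u
  ... | yes _ | yes _ = refl
  ... | no  _ | no  _ = refl
  ... | yes p | no ¬q = Data.Empty.⊥-elim (¬q (≡sym p)) where import Data.Empty
  ... | no ¬p | yes q = Data.Empty.⊥-elim (¬p (≡sym q)) where import Data.Empty

P2× : ∀ {n} → Graph (Fin n) → Graph (Bool × Fin n)
adj   (P2× T) = P2×adj (adj T)
Graph.sym (P2× T) (x , u) (y , v) rewrite beq-sym x y with beq y x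
... | true  = Graph.sym T u v
... | false = feq-sym u v
irrfl (P2× T) (false , v) = irrfl T v
irrfl (P2× T) (true  , v) = irrfl T v

-- Every cycle of P₂ × T, whatever its length, has an odd number of edges
-- directed along it; as each edge is directed exactly one way, the backward
-- count of a cycle of even length is then odd as well. Project a cycle to T and contract its rungs: this
-- is a closed walk in the forest T, so it turns back somewhere, and as the
-- cycle repeats no vertex, the turn comes from three sides
-- (l,p) (l,q) (l′,q) (l′,p) of a square of the ladder. Replacing them by the
-- fourth side, the rung (l,p) (l′,p), shortens the cycle by two and changes the
-- forward count by an even number: the two horizontal sides lie in oppositely
-- oriented copies of T and are traversed in opposite directions, and both rungs
-- lead from layer l to layer l′. The induction ends with a rung traversed back
-- and forth, which has forward count 1.

{-# OPTIONS --safe #-}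
module Submission where

open import Defs hiding (sym)
open import Algebra.Properties.CommutativeSemigroup using (interchange)
open import Data.Bool using (Bool; true; false; _xor_)
open import Data.Bool.Properties using (¬-not)
open import Data.Empty using (⊥-elim)
open import Data.Fin using (Fin; zero; suc; toℕ; inject₁; fromℕ)
import Data.Fin as Fin
open import Data.Fin.Properties
  using (toℕ-fromℕ<; toℕ-inject₁; toℕ-fromℕ; toℕ-injective; inject₁ℕ<)
open import Data.List using (List; []; _∷_; _++_; [_]; _∷ʳ_; take; map; tabulate; lookup; length; derun)
open import Data.List.Properties using (++-assoc; ∷-injective; tabulate-lookup; tabulate-cong; derun-accept)
open import Data.List.Membership.Propositional using (_∈_)
open import Data.List.Membership.Propositional.Properties using (∈-derun⁺; ∈-map⁺; ∈-++⁺ʳ; ∈-lookup)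
open import Data.List.Relation.Unary.All as All using (All; []; _∷_)
import Data.List.Relation.Unary.All.Properties as All
open import Data.List.Relation.Unary.Any using (here; there)
open import Data.List.Relation.Unary.AllPairs using ([]; _∷_)
open import Data.List.Relation.Unary.Linked as Linked using (Linked; []; [-]; _∷_)
import Data.List.Relation.Unary.Linked.Properties as Linked
open import Data.List.Relation.Unary.Unique.Propositional using (Unique)
open import Data.List.Relation.Unary.Unique.Propositional.Properties as Unique
  using (tabulate⁺; Unique[x∷xs]⇒x∉xs)
open import Data.Nat using (ℕ; zero; suc; _+_; _*_; _%_; _<_; _≤_; z≤n; s≤s)
open import Data.Nat.DivMod using (m<n⇒m%n≡m; n%n≡0)
open import Data.Nat.Induction using (<-wellFounded)
open import Data.Nat.Properties using (+-identityʳ; +-assoc; +-suc; n≤1+n; even≢odd; +-commutativeSemigroup)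
open import Data.Nat.Tactic.RingSolver using (solve-∀)
open import Data.Product using (∃; ∃₂; _×_; _,_; proj₁; proj₂)
open import Data.Sum using (_⊎_; inj₁; inj₂; fromInj₂)
open import Data.Unit using (⊤; tt)
open import Function using (_∘_)
open import Induction.WellFounded using (Acc; acc)
open import Relation.Binary.Definitions using (DecidableEquality)
open import Relation.Binary.PropositionalEquality
  using (_≡_; _≢_; refl; sym; trans; cong; cong₂; subst; module ≡-Reasoning)
open import Relation.Nullary using (¬_; yes; no; contradiction)
open import Relation.Nullary.Decidable using (_×-dec_)

private variable
  A B : Set
  R : A → A → Set
  x y z : A
  xs ys zs : List A

-- Walks as lists

closed : List A → List A
closed xs = xs ++ take 1 xs

pathSum : (A → A → ℕ) → List A → ℕ
pathSum h (x ∷ y ∷ xs) = h x y + pathSum h (y ∷ xs)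
pathSum h _            = 0

NonBacktracking : List A → Set
NonBacktracking (x ∷ y ∷ z ∷ xs) = x ≢ z × NonBacktracking (y ∷ z ∷ xs)
NonBacktracking _                = ⊤

HairpinFree : List A → Set
HairpinFree (w ∷ x ∷ y ∷ z ∷ xs) = ¬ (w ≡ z × x ≡ y) × HairpinFree (x ∷ y ∷ z ∷ xs)
HairpinFree _                    = ⊤

record Hairpin {A B : Set} (f : A → B) (ws : List A) : Set where
  field
    before after : List A
    a b c d      : A
    split        : ws ≡ before ++ a ∷ b ∷ c ∷ d ∷ after
    ends         : f a ≡ f d
    middle       : f b ≡ f c

hairpin-∷ : ∀ {f : A → B} → Hairpin f xs → Hairpin f (x ∷ xs)
hairpin-∷ {x = x} h = record
  { before = x ∷ before ; after = after ; a = a ; b = b ; c = c ; d = d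
  ; split = cong (x ∷_) split ; ends = ends ; middle = middle }
  where open Hairpin h

hairpin? : DecidableEquality B → (f : A → B) → ∀ ws → Hairpin f ws ⊎ HairpinFree (map f ws)
hairpin? _≟_ f (a ∷ b ∷ c ∷ d ∷ ws)
  with (f a ≟ f d) ×-dec (f b ≟ f c) | hairpin? _≟_ f (b ∷ c ∷ d ∷ ws)
... | yes (ends , middle) | _         =
  inj₁ (record { before = [] ; after = ws ; split = refl ; ends = ends ; middle = middle })
... | no _                | inj₁ h    = inj₁ (hairpin-∷ h)
... | no ¬hairpin         | inj₂ free = inj₂ (¬hairpin , free)
hairpin? _ f []               = inj₂ tt
hairpin? _ f (_ ∷ [])         = inj₂ tt
hairpin? _ f (_ ∷ _ ∷ [])     = inj₂ tt
hairpin? _ f (_ ∷ _ ∷ _ ∷ []) = inj₂ tt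

linked-++⁻ˡ : ∀ xs → Linked R (xs ++ ys) → Linked R xs
linked-++⁻ˡ []           _          = []
linked-++⁻ˡ (_ ∷ [])     _          = [-]
linked-++⁻ˡ (x ∷ y ∷ xs) (r ∷ walk) = r ∷ linked-++⁻ˡ (y ∷ xs) walk

linked-++⁻ʳ : ∀ xs → Linked R (xs ++ ys) → Linked R ys
linked-++⁻ʳ []       walk = walk
linked-++⁻ʳ (_ ∷ xs) walk = linked-++⁻ʳ xs (Linked.tail walk)

linked-replace-suffix : ∀ xs → Linked R (xs ++ x ∷ ys) → (Linked R (x ∷ ys) → Linked R (x ∷ zs)) →
                        Linked R (xs ++ x ∷ zs)
linked-replace-suffix []           walk       f = f walk
linked-replace-suffix (_ ∷ [])     (r ∷ walk) f = r ∷ f walk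
linked-replace-suffix (_ ∷ v ∷ xs) (r ∷ walk) f = r ∷ linked-replace-suffix (v ∷ xs) walk f

pathSum-++-∷ : ∀ (h : A → A → ℕ) xs →
               pathSum h (xs ++ x ∷ ys) ≡ pathSum h (xs ∷ʳ x) + pathSum h (x ∷ ys)
pathSum-++-∷ h []           = refl
pathSum-++-∷ {x = x} {ys = ys} h (w ∷ []) = cong (_+ pathSum h (x ∷ ys)) (sym (+-identityʳ (h w x)))
pathSum-++-∷ h (w ∷ v ∷ xs) =
  trans (cong (h w v +_) (pathSum-++-∷ h (v ∷ xs))) (sym (+-assoc (h w v) _ _))

nonBacktracking-tail : NonBacktracking (x ∷ xs) → NonBacktracking xs
nonBacktracking-tail {xs = []}        _        = tt
nonBacktracking-tail {xs = _ ∷ []}    _        = tt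
nonBacktracking-tail {xs = _ ∷ _ ∷ _} (_ , nb) = nb

nonBacktracking-++⁻ʳ : ∀ xs → NonBacktracking (xs ++ ys) → NonBacktracking ys
nonBacktracking-++⁻ʳ []       nb = nb
nonBacktracking-++⁻ʳ (_ ∷ xs) nb = nonBacktracking-++⁻ʳ xs (nonBacktracking-tail nb)

hairpinFree-tail : HairpinFree (x ∷ xs) → HairpinFree xs
hairpinFree-tail {xs = []}            _          = tt
hairpinFree-tail {xs = _ ∷ []}        _          = tt
hairpinFree-tail {xs = _ ∷ _ ∷ []}    _          = tt
hairpinFree-tail {xs = _ ∷ _ ∷ _ ∷ _} (_ , free) = free

unique⇒nonBacktracking : Unique xs → NonBacktracking xs
unique⇒nonBacktracking {xs = []}            _                    = tt
unique⇒nonBacktracking {xs = _ ∷ []}        _                    = tt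
unique⇒nonBacktracking {xs = _ ∷ _ ∷ []}    _                    = tt
unique⇒nonBacktracking {xs = _ ∷ _ ∷ _ ∷ _} ((_ ∷ x≢z ∷ _) ∷ u) = x≢z , unique⇒nonBacktracking u

unique-++⁻ˡ : ∀ xs → Unique (xs ++ ys) → Unique xs
unique-++⁻ˡ []       _        = []
unique-++⁻ˡ (_ ∷ xs) (x∉ ∷ u) = proj₁ (All.++⁻ xs x∉) ∷ unique-++⁻ˡ xs u

all-shortcut : ∀ {P : A → Set} xs {a b c} → All P (xs ++ a ∷ b ∷ c ∷ ys) → All P (xs ++ a ∷ ys)
all-shortcut xs all with pxs , pa ∷ _ ∷ _ ∷ pys ← All.++⁻ xs all = All.++⁺ pxs (pa ∷ pys)

unique-shortcut : ∀ xs {a b c} → Unique (xs ++ a ∷ b ∷ c ∷ ys) → Unique (xs ++ a ∷ ys)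
unique-shortcut []       ((_ ∷ _ ∷ a∉ys) ∷ _ ∷ _ ∷ u) = a∉ys ∷ u
unique-shortcut (_ ∷ xs) (x∉ ∷ u)                      = all-shortcut xs x∉ ∷ unique-shortcut xs u

unique-∷ʳ : Unique (x ∷ xs) → Unique (xs ∷ʳ x)
unique-∷ʳ (x∉ ∷ u) = Unique.++⁺ u ([] ∷ []) λ { (x∈ , here refl) → All.lookup x∉ x∈ refl }

closed-nonBacktracking : Unique (x ∷ y ∷ z ∷ xs) → NonBacktracking (closed (x ∷ y ∷ z ∷ xs))
closed-nonBacktracking u@((_ ∷ x≢z ∷ _) ∷ _) = x≢z , unique⇒nonBacktracking (unique-∷ʳ u)

first-occurrence : DecidableEquality A → ∀ x xs →
                   All (x ≢_) xs ⊎ ∃₂ λ mid post → xs ≡ mid ++ x ∷ post × All (x ≢_) mid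
first-occurrence _≟_ x [] = inj₁ []
first-occurrence _≟_ x (y ∷ xs) with x ≟ y | first-occurrence _≟_ x xs
... | yes refl | _                                 = inj₂ ([] , xs , refl , [])
... | no x≢y   | inj₁ x∉xs                         = inj₁ (x≢y ∷ x∉xs)
... | no x≢y   | inj₂ (mid , post , refl , x∉mid) = inj₂ (y ∷ mid , post , refl , x≢y ∷ x∉mid)

∷ʳ-split : ∀ xs ys → xs ∷ʳ x ≡ ys ++ y ∷ zs → ∃ λ ws → xs ≡ ys ++ ws × ws ∷ʳ x ≡ y ∷ zs
∷ʳ-split xs       []          e = xs , refl , e
∷ʳ-split []       (_ ∷ [])    ()
∷ʳ-split []       (_ ∷ _ ∷ _) ()
∷ʳ-split (_ ∷ xs) (_ ∷ ys)    e
  with refl , e′ ← ∷-injective e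
  with ws , refl , e″ ← ∷ʳ-split xs ys e′ = ws , refl , e″

take-1-++-∷ : ∀ xs → take 1 (xs ++ x ∷ ys) ≡ take 1 (xs ++ x ∷ zs)
take-1-++-∷ []      = refl
take-1-++-∷ (_ ∷ _) = refl

closed-shortcut : ∀ before {a b c d after} → closed (x ∷ xs) ≡ before ++ a ∷ b ∷ c ∷ d ∷ after →
                  ∃ λ ws → x ∷ xs ≡ before ++ a ∷ b ∷ c ∷ ws ×
                           closed (before ++ a ∷ ws) ≡ before ++ a ∷ d ∷ after
closed-shortcut {x = x} {xs} before {a} {b} {c} {d} {after} e
  with ws , C≡ , ws∷ʳx ← ∷ʳ-split (x ∷ xs) (before ++ a ∷ b ∷ c ∷ [])
                                   (trans e (sym (++-assoc before _ _))) =
  ws , C≡′ , (begin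
    (before ++ a ∷ ws) ++ take 1 (before ++ a ∷ ws)  ≡⟨ cong ((before ++ a ∷ ws) ++_) first ⟩
    (before ++ a ∷ ws) ++ [ x ]                     ≡⟨ ++-assoc before (a ∷ ws) [ x ] ⟩
    before ++ a ∷ ws ∷ʳ x                           ≡⟨ cong (λ t → before ++ a ∷ t) ws∷ʳx ⟩
    before ++ a ∷ d ∷ after                         ∎)
  where
  open ≡-Reasoning
  C≡′ : x ∷ xs ≡ before ++ a ∷ b ∷ c ∷ ws
  C≡′ = trans C≡ (++-assoc before (a ∷ b ∷ c ∷ []) ws)
  first : take 1 (before ++ a ∷ ws) ≡ [ x ]
  first = trans (take-1-++-∷ before) (cong (take 1) (sym C≡′))

length-shortcut : ∀ xs {a b c} → length (xs ++ a ∷ ys) < length (xs ++ a ∷ b ∷ c ∷ ys)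
length-shortcut []       = s≤s (s≤s (n≤1+n _))
length-shortcut (_ ∷ xs) = s≤s (length-shortcut xs)

++-∷-nonempty : ∀ xs → xs ++ x ∷ ys ≢ []
++-∷-nonempty []      ()
++-∷-nonempty (_ ∷ _) ()

-- Contracting runs of equal entries

module _ (_≟_ : DecidableEquality A) where

  derun-∷ : ∀ x xs → ∃ λ ys → derun _≟_ (x ∷ xs) ≡ x ∷ ys
  derun-∷ x []       = [] , refl
  derun-∷ x (y ∷ xs) with x ≟ y
  ... | yes refl = derun-∷ x xs
  ... | no _     = derun _≟_ (y ∷ xs) , refl

  derun-∷-∷ : x ≢ y → ∃ λ ys → derun _≟_ (x ∷ y ∷ xs) ≡ x ∷ y ∷ ys
  derun-∷-∷ {y = y} {xs} x≢y =
    let ys , e = derun-∷ y xs in ys , trans (derun-accept _≟_ xs x≢y) (cong (_ ∷_) e)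

  derun-linked : Linked (λ u v → u ≡ v ⊎ R u v) xs → Linked R (derun _≟_ xs)
  derun-linked []  = []
  derun-linked [-] = [-]
  derun-linked {xs = x ∷ y ∷ xs} (step ∷ walk) with x ≟ y | derun-∷ y xs | derun-linked walk
  ... | yes refl | _      | walk′ = walk′
  ... | no x≢y   | ys , e | walk′ rewrite e = fromInj₂ (⊥-elim ∘ x≢y) step ∷ walk′

  nonBacktracking-derun-∷ : ∀ {x y} xs → NonBacktracking (x ∷ y ∷ xs) → HairpinFree (x ∷ y ∷ xs) →
                            NonBacktracking (derun _≟_ (y ∷ xs)) →
                            NonBacktracking (x ∷ derun _≟_ (y ∷ xs))
  nonBacktracking-derun-∷ [] _ _ _ = tt
  nonBacktracking-derun-∷ {y = y} (z ∷ xs) (x≢z , _) _ nb with y ≟ z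
  ... | no _ with ys , e ← derun-∷ z xs rewrite e = x≢z , nb
  nonBacktracking-derun-∷ (_ ∷ [])     _             _             _  | yes refl = tt
  nonBacktracking-derun-∷ (_ ∷ w ∷ xs) (_ , y≢w , _) (¬hairpin , _) nb | yes refl
    with ys , e ← derun-∷-∷ {xs = xs} y≢w rewrite e = (λ x≡w → ¬hairpin (x≡w , refl)) , nb

  derun-nonBacktracking : ∀ xs → NonBacktracking xs → HairpinFree xs → NonBacktracking (derun _≟_ xs)
  derun-nonBacktracking []           _  _    = tt
  derun-nonBacktracking (_ ∷ [])     _  _    = tt
  derun-nonBacktracking (x ∷ y ∷ xs) nb free
    with x ≟ y | derun-nonBacktracking (y ∷ xs) (nonBacktracking-tail nb) (hairpinFree-tail free)
  ... | yes refl | nb′ = nb′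
  ... | no _     | nb′ = nonBacktracking-derun-∷ xs nb free nb′

  derun-revisits : ∀ zs → x ≢ z → x ∈ z ∷ zs → ¬ Unique (derun _≟_ (x ∷ y ∷ z ∷ zs))
  derun-revisits {x = x} {y = y} zs x≢z x∈ u with x ≟ y
  ... | yes refl = Unique[x∷xs]⇒x∉xs (subst Unique (derun-accept _≟_ zs x≢z) u) (∈-derun⁺ _≟_ x∈)
  ... | no _     = Unique[x∷xs]⇒x∉xs u (∈-derun⁺ _≟_ (there x∈))

even-or-odd : ∀ n → Even n ⊎ Odd n
even-or-odd zero = inj₁ (0 , refl)
even-or-odd (suc n) with even-or-odd n
... | inj₁ (m , refl) = inj₂ (m , refl)
... | inj₂ (m , refl) = inj₁ (suc m , cong suc (sym (+-suc m (m + 0))))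

odd-complement : ∀ {m n} → Odd m → Even (m + n) → Odd n
odd-complement {n = n} (a , refl) (b , e) with even-or-odd n
... | inj₂ odd        = odd
... | inj₁ (c , refl) = ⊥-elim (even≢odd b (a + c) (trans (sym e) (regroup a c)))
  where
  regroup : ∀ a c → suc (2 * a) + 2 * c ≡ suc (2 * (a + c))
  regroup = solve-∀

odd-double-+ : ∀ t {n} → Odd n → Odd (2 * t + n)
odd-double-+ t (a , refl) = t + a , regroup t a
  where
  regroup : ∀ t a → 2 * t + suc (2 * a) ≡ suc (2 * (t + a))
  regroup = solve-∀

sumFin-cong : ∀ {k} {f g : Fin k → ℕ} → (∀ i → f i ≡ g i) → sumFin f ≡ sumFin g
sumFin-cong {zero}  _ = refl
sumFin-cong {suc k} e = cong₂ _+_ (e zero) (sumFin-cong (e ∘ suc))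

sumFin-complement : ∀ {k} (f g : Fin k → ℕ) → (∀ i → f i + g i ≡ 1) → sumFin f + sumFin g ≡ k
sumFin-complement {zero}  _ _ _ = refl
sumFin-complement {suc k} f g e =
  trans (interchange +-commutativeSemigroup (f zero) _ (g zero) _)
        (cong₂ _+_ (e zero) (sumFin-complement (f ∘ suc) (g ∘ suc) (e ∘ suc)))

cnext-inject₁ : ∀ {m} (i : Fin m) → cnext {suc m} (inject₁ i) ≡ suc i
cnext-inject₁ {m} i = toℕ-injective (begin
  toℕ (cnext (inject₁ i))        ≡⟨ toℕ-fromℕ< _ ⟩
  suc (toℕ (inject₁ i)) % suc m  ≡⟨ m<n⇒m%n≡m (s≤s (inject₁ℕ< i)) ⟩
  suc (toℕ (inject₁ i))          ≡⟨ cong suc (toℕ-inject₁ i) ⟩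
  suc (toℕ i)                    ∎)
  where open ≡-Reasoning

cnext-fromℕ : ∀ m → cnext {suc m} (fromℕ m) ≡ zero
cnext-fromℕ m = toℕ-injective (begin
  toℕ (cnext (fromℕ m))        ≡⟨ toℕ-fromℕ< _ ⟩
  suc (toℕ (fromℕ m)) % suc m  ≡⟨ cong (λ k → suc k % suc m) (toℕ-fromℕ m) ⟩
  suc m % suc m                ≡⟨ n%n≡0 (suc m) ⟩
  0                            ∎)
  where open ≡-Reasoning

-- Entry j of the closed walk v₀ v₁ … vₘ v₀ is the vertex v (closedIndex j).
closedIndex : ∀ {m} → Fin (suc (suc m)) → Fin (suc m)
closedIndex zero    = zero
closedIndex (suc i) = cnext i

closedIndex-inject₁ : ∀ {m} (i : Fin (suc m)) → closedIndex (inject₁ i) ≡ i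
closedIndex-inject₁ zero    = refl
closedIndex-inject₁ (suc i) = cnext-inject₁ i

tabulate-∷ʳ : ∀ {k} (f : Fin (suc k) → A) → tabulate f ≡ tabulate (f ∘ inject₁) ∷ʳ f (fromℕ k)
tabulate-∷ʳ {k = zero}  f = refl
tabulate-∷ʳ {k = suc k} f = cong (f zero ∷_) (tabulate-∷ʳ (f ∘ suc))

closed-tabulate : ∀ {m} (v : Fin (suc m) → A) → closed (tabulate v) ≡ tabulate (v ∘ closedIndex)
closed-tabulate {m = m} v = cong (v zero ∷_) (sym (begin
  tabulate (v ∘ cnext)                                   ≡⟨ tabulate-∷ʳ (v ∘ cnext) ⟩
  tabulate (v ∘ cnext ∘ inject₁) ∷ʳ v (cnext (fromℕ m))  ≡⟨ cong₂ _∷ʳ_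
                                                               (tabulate-cong (cong v ∘ cnext-inject₁))
                                                               (cong v (cnext-fromℕ m)) ⟩
  tabulate (v ∘ suc) ∷ʳ v zero                           ∎))
  where open ≡-Reasoning

linked-tabulate⁺ : ∀ {k} (f : Fin (suc k) → A) → (∀ i → R (f (inject₁ i)) (f (suc i))) →
                   Linked R (tabulate f)
linked-tabulate⁺ {k = zero}  f _ = [-]
linked-tabulate⁺ {k = suc k} f r = r zero ∷ linked-tabulate⁺ (f ∘ suc) (r ∘ suc)

linked-tabulate⁻ : ∀ {k} (f : Fin (suc k) → A) → Linked R (tabulate f) →
                   ∀ i → R (f (inject₁ i)) (f (suc i))
linked-tabulate⁻ {k = suc k} f (r ∷ _)    zero    = r
linked-tabulate⁻ {k = suc k} f (_ ∷ walk) (suc i) = linked-tabulate⁻ (f ∘ suc) walk i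

pathSum-tabulate : ∀ (h : A → A → ℕ) {k} (f : Fin (suc k) → A) →
                   pathSum h (tabulate f) ≡ sumFin (λ i → h (f (inject₁ i)) (f (suc i)))
pathSum-tabulate h {zero}  f = refl
pathSum-tabulate h {suc k} f = cong (h (f zero) (f (suc zero)) +_) (pathSum-tabulate h (f ∘ suc))

module _ {m} (v : Fin (suc m) → A) where

  linked-closed-tabulate⁺ : (∀ i → R (v i) (v (cnext i))) → Linked R (closed (tabulate v))
  linked-closed-tabulate⁺ {R = R} r = subst (Linked R) (sym (closed-tabulate v))
    (linked-tabulate⁺ (v ∘ closedIndex) λ i →
      subst (λ j → R (v j) (v (cnext i))) (sym (closedIndex-inject₁ i)) (r i))

  linked-closed-tabulate⁻ : Linked R (closed (tabulate v)) → ∀ i → R (v i) (v (cnext i))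
  linked-closed-tabulate⁻ {R = R} walk i = subst (λ j → R (v j) (v (cnext i))) (closedIndex-inject₁ i)
    (linked-tabulate⁻ (v ∘ closedIndex) (subst (Linked R) (closed-tabulate v) walk) i)

  pathSum-closed-tabulate : ∀ (h : A → A → ℕ) →
                            pathSum h (closed (tabulate v)) ≡ sumFin (λ i → h (v i) (v (cnext i)))
  pathSum-closed-tabulate h = trans (cong (pathSum h) (closed-tabulate v))
    (trans (pathSum-tabulate h (v ∘ closedIndex))
           (sumFin-cong λ i → cong (λ j → h (v j) (v (cnext i))) (closedIndex-inject₁ i)))

Adj : {V : Set} → Graph V → V → V → Set
Adj G u v = adj G u v ≡ true

adj-irrefl : ∀ {V} (G : Graph V) {v} → ¬ Adj G v v
adj-irrefl G {v} e = contradiction (trans (sym (irrfl G v)) e) λ ()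

arcWeight : {V : Set} → (V → V → Bool) → V → V → ℕ
arcWeight arc u v = b2n (arc u v)

xor-weights : ∀ p q → (p xor q) ≡ true → b2n p + b2n q ≡ 1
xor-weights true  false _ = refl
xor-weights false true  _ = refl

orientation-weights : ∀ {V} {G : Graph V} {arc u v} → IsOrientation G arc → Adj G u v →
                      arcWeight arc u v + arcWeight arc v u ≡ 1
orientation-weights {arc = arc} {u} {v} (_ , one-way) e = xor-weights (arc u v) (arc v u) (one-way u v e)

forward+backward : ∀ {V} {G : Graph V} {arc} → IsOrientation G arc → (C : Cycle G) →
                   forwardCount arc C + backwardCount arc C ≡ len C
forward+backward {G = G} o C = sumFin-complement _ _ λ i → orientation-weights {G = G} o (vx-adj C i)

lookup-injective : Unique xs → ∀ {i j} → lookup xs i ≡ lookup xs j → i ≡ j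
lookup-injective (_  ∷ _) {zero}  {zero}  _ = refl
lookup-injective (x∉ ∷ _) {zero}  {suc j} e = ⊥-elim (All.lookup x∉ (∈-lookup j) e)
lookup-injective (x∉ ∷ _) {suc i} {zero}  e = ⊥-elim (All.lookup x∉ (∈-lookup i) (sym e))
lookup-injective (_  ∷ u) {suc i} {suc j} e = cong suc (lookup-injective u e)

-- Forests

module _ {V : Set} (G : Graph V) where

  listCycle : ∀ {x xs} → Unique (x ∷ xs) → 2 ≤ length xs → Linked (Adj G) (closed (x ∷ xs)) → Cycle G
  listCycle {x} {xs} u long walk = record
    { len    = suc (length xs)
    ; len≥3  = s≤s long
    ; vx     = lookup (x ∷ xs)
    ; vx-inj = lookup-injective u
    ; vx-adj = linked-closed-tabulate⁻ (lookup (x ∷ xs))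
                 (subst (Linked (Adj G) ∘ closed) (sym (tabulate-lookup (x ∷ xs))) walk)
    }

  returning-walk-cycle : ∀ {x} mid post → Unique (x ∷ mid) → Linked (Adj G) (x ∷ mid ++ x ∷ post) →
                         NonBacktracking (x ∷ mid ++ x ∷ post) → Cycle G
  returning-walk-cycle []       post _ (x∼x ∷ _) _         = ⊥-elim (adj-irrefl G x∼x)
  returning-walk-cycle (y ∷ []) post _ _         (x≢x , _) = ⊥-elim (x≢x refl)
  returning-walk-cycle {x} (y ∷ z ∷ mid) post u walk _ = listCycle u (s≤s (s≤s z≤n))
    (linked-++⁻ˡ (closed (x ∷ y ∷ z ∷ mid))
      (subst (Linked (Adj G)) (cong (λ t → x ∷ y ∷ z ∷ t) (sym (++-assoc mid [ x ] post))) walk))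

  nonBacktracking-walk⇒unique : DecidableEquality V → ¬ Cycle G →
                                ∀ {xs} → Linked (Adj G) xs → NonBacktracking xs → Unique xs
  nonBacktracking-walk⇒unique _≟_ acyclic {[]} _ _ = []
  nonBacktracking-walk⇒unique _≟_ acyclic {x ∷ xs} walk nb
    with first-occurrence _≟_ x xs
       | nonBacktracking-walk⇒unique _≟_ acyclic (Linked.tail walk) (nonBacktracking-tail nb)
  ... | inj₁ x∉xs                        | unique-xs = x∉xs ∷ unique-xs
  ... | inj₂ (mid , post , refl , x∉mid) | unique-xs =
    ⊥-elim (acyclic (returning-walk-cycle mid post (x∉mid ∷ unique-++⁻ˡ mid unique-xs) walk nb))

-- The ladder P₂ × T

xor-comm : ∀ p q → (p xor q) ≡ (q xor p)
xor-comm true  true  = refl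
xor-comm true  false = refl
xor-comm false true  = refl
xor-comm false false = refl

feq-refl : ∀ {n} (p : Fin n) → feq p p ≡ true
feq-refl p with p Fin.≟ p
... | yes _  = refl
... | no p≢p = ⊥-elim (p≢p refl)

feq⇒≡ : ∀ {n} {p q : Fin n} → feq p q ≡ true → p ≡ q
feq⇒≡ {p = p} {q} e with p Fin.≟ q
... | yes p≡q = p≡q
feq⇒≡ () | no _

module Ladder {n} (T : Graph (Fin n)) (arc : Fin n → Fin n → Bool) where

  infix 4 _∼_
  _∼_ : Bool × Fin n → Bool × Fin n → Set
  _∼_ = Adj (P2× T)

  w : Bool × Fin n → Bool × Fin n → ℕ
  w = arcWeight (P2×arc arc)

  ladder-isOrientation : IsOrientation T arc → IsOrientation (P2× T) (P2×arc arc)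
  ladder-isOrientation (arc⇒adj , one-way) = arc⇒adj′ , one-way′
    where
    arc⇒adj′ : ∀ u v → P2×arc arc u v ≡ true → u ∼ v
    arc⇒adj′ (false , p) (false , q) e = arc⇒adj p q e
    arc⇒adj′ (true  , p) (true  , q) e = trans (Graph.sym T p q) (arc⇒adj q p e)
    arc⇒adj′ (false , p) (true  , q) e = e
    arc⇒adj′ (true  , p) (false , q) ()
    one-way′ : ∀ u v → u ∼ v → (P2×arc arc u v xor P2×arc arc v u) ≡ true
    one-way′ (false , p) (false , q) e = one-way p q e
    one-way′ (true  , p) (true  , q) e = trans (xor-comm (arc q p) (arc p q)) (one-way p q e)
    one-way′ (false , p) (true  , q) e rewrite e = refl
    one-way′ (true  , p) (false , q) e = subst (λ r → feq r p ≡ true) (feq⇒≡ e) (feq-refl p)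

  shadow-step : ∀ {l l′ p q} → (l , p) ∼ (l′ , q) → p ≡ q ⊎ (l ≡ l′ × Adj T p q)
  shadow-step {false} {false} e = inj₂ (refl , e)
  shadow-step {true}  {true}  e = inj₂ (refl , e)
  shadow-step {false} {true}  e = inj₁ (feq⇒≡ e)
  shadow-step {true}  {false} e = inj₁ (feq⇒≡ e)

  rung-layers : ∀ {l l′ p} → (l , p) ∼ (l′ , p) → l ≢ l′
  rung-layers {l} {p = p} e refl = adj-irrefl (P2× T) {l , p} e

  fibre-return : ∀ {l l′ l″ p q} → (l , p) ∼ (l′ , q) → (l′ , q) ∼ (l″ , p) → l ≡ l″
  fibre-return {l} {l′} {l″} {p} {q} uv vw
    with shadow-step {l} {l′} {p} {q} uv | shadow-step {l′} {l″} {q} {p} vw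
  ... | inj₁ refl       | _               =
    trans (¬-not (rung-layers {l} {l′} {p} uv)) (sym (¬-not (rung-layers {l′} {l″} {p} vw ∘ sym)))
  ... | inj₂ (_ , pq)   | inj₁ refl       = ⊥-elim (adj-irrefl T pq)
  ... | inj₂ (refl , _) | inj₂ (refl , _) = refl

  shadow-nonBacktracking : ∀ ws → Linked _∼_ ws → NonBacktracking ws → NonBacktracking (map proj₂ ws)
  shadow-nonBacktracking []           _ _ = tt
  shadow-nonBacktracking (_ ∷ [])     _ _ = tt
  shadow-nonBacktracking (_ ∷ _ ∷ []) _ _ = tt
  shadow-nonBacktracking ((l , p) ∷ (l′ , q) ∷ (l″ , r) ∷ ws) (uv ∷ vw ∷ walk) (u≢w , nb) =
    (λ { refl → u≢w (cong (_, p) (fibre-return {l} {l′} {l″} {p} {q} uv vw)) }) ,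
    shadow-nonBacktracking (_ ∷ _ ∷ ws) (vw ∷ walk) nb

  rung-square : ∀ {l l′ p q} → l ≢ l′ →
                (l , p) ∼ (l′ , p) ×
                w (l′ , q) (l′ , p) ≡ w (l , p) (l , q) ×
                w (l , q) (l′ , q) ≡ w (l , p) (l′ , p)
  rung-square {false} {false} l≢l′ = ⊥-elim (l≢l′ refl)
  rung-square {true}  {true}  l≢l′ = ⊥-elim (l≢l′ refl)
  rung-square {false} {true}  {p} {q} _ rewrite feq-refl p | feq-refl q = refl , refl , refl
  rung-square {true}  {false} {p}     _ rewrite feq-refl p              = refl , refl , refl

  square : ∀ {l l₁ l₂ l₃ p q} → (l , p) ∼ (l₁ , q) → (l₁ , q) ∼ (l₂ , q) →
           (l₂ , q) ∼ (l₃ , p) → (l , p) ≢ (l₂ , q) →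
           (l , p) ∼ (l₃ , p) ×
           w (l₂ , q) (l₃ , p) ≡ w (l , p) (l₁ , q) ×
           w (l₁ , q) (l₂ , q) ≡ w (l , p) (l₃ , p)
  square {l} {l₁} {l₂} {l₃} {p} {q} ab bc cd a≢c
    with shadow-step {l} {l₁} {p} {q} ab | shadow-step {l₂} {l₃} {q} {p} cd
  ... | inj₁ refl       | _         = ⊥-elim (a≢c (cong (_, p) (fibre-return {l} {l₁} {l₂} {p} {p} ab bc)))
  ... | inj₂ _          | inj₁ refl = ⊥-elim (a≢c (cong (_, q) (fibre-return {l} {l₁} {l₂} {q} {q} ab bc)))
  ... | inj₂ (refl , _) | inj₂ (refl , _) =
    rung-square {l} {l₂} {p} {q} (rung-layers {l} {l₂} {q} bc)

  square-shortcut : ∀ before {a b c d} after →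
                    Linked _∼_ (before ++ a ∷ b ∷ c ∷ d ∷ after) →
                    NonBacktracking (before ++ a ∷ b ∷ c ∷ d ∷ after) →
                    proj₂ a ≡ proj₂ d → proj₂ b ≡ proj₂ c →
                    Linked _∼_ (before ++ a ∷ d ∷ after) ×
                    pathSum w (before ++ a ∷ b ∷ c ∷ d ∷ after) ≡
                      2 * w a b + pathSum w (before ++ a ∷ d ∷ after)
  square-shortcut before {a@(l , p)} {b@(l₁ , q)} {c@(l₂ , _)} {d@(l₃ , _)} after walk nb refl refl
    with ab ∷ bc ∷ cd ∷ rest ← linked-++⁻ʳ before walk | a≢c , _ ← nonBacktracking-++⁻ʳ before nb
    with ad , cd≡ab , bc≡ad ← square {l} {l₁} {l₂} {l₃} {p} {q} ab bc cd a≢c =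
    linked-replace-suffix before walk (λ _ → ad ∷ rest) , (begin
      pathSum w (before ++ a ∷ b ∷ c ∷ d ∷ after)  ≡⟨ pathSum-++-∷ w before ⟩
      S + (t + (w b c + (w c d + Rest)))           ≡⟨ cong₂ (λ x y → S + (t + (x + (y + Rest))))
                                                              bc≡ad cd≡ab ⟩
      S + (t + (u + (t + Rest)))                   ≡⟨ regroup S t u Rest ⟩
      2 * t + (S + (u + Rest))                     ≡⟨ cong (2 * t +_) (pathSum-++-∷ w before) ⟨
      2 * t + pathSum w (before ++ a ∷ d ∷ after)  ∎)
    where
    open ≡-Reasoning
    S    = pathSum w (before ∷ʳ a)
    Rest = pathSum w (d ∷ after)
    t    = w a b
    u    = w a d
    regroup : ∀ s t u r → s + (t + (u + (t + r))) ≡ 2 * t + (s + (u + r))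
    regroup = solve-∀

-- Cycles of the ladder

module _ {n} {T : Graph (Fin n)} (acyclic : ¬ Cycle T) {arc} (orient : IsOrientation T arc) where
  open Ladder T arc

  shadow-lazy : ∀ {u v} → u ∼ v → proj₂ u ≡ proj₂ v ⊎ Adj T (proj₂ u) (proj₂ v)
  shadow-lazy {l , p} {l′ , q} e with shadow-step {l} {l′} {p} {q} e
  ... | inj₁ p≡q       = inj₁ p≡q
  ... | inj₂ (_ , adj) = inj₂ adj

  cycle-shadow-¬hairpinFree : ∀ {x y z xs} → Unique (x ∷ y ∷ z ∷ xs) →
                              Linked _∼_ (closed (x ∷ y ∷ z ∷ xs)) →
                              ¬ HairpinFree (map proj₂ (closed (x ∷ y ∷ z ∷ xs)))
  cycle-shadow-¬hairpinFree {x} {y} {z} {xs} u walk free =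
    derun-revisits Fin._≟_ (map proj₂ (xs ∷ʳ x)) (proj₁ shadow-nb) returns
      (nonBacktracking-walk⇒unique T Fin._≟_ acyclic tree-walk
        (derun-nonBacktracking Fin._≟_ _ shadow-nb free))
    where
    shadow    = map proj₂ (closed (x ∷ y ∷ z ∷ xs))
    shadow-nb = shadow-nonBacktracking _ walk (closed-nonBacktracking u)
    tree-walk : Linked (Adj T) (derun Fin._≟_ shadow)
    tree-walk = derun-linked Fin._≟_
      (Linked.map⁺ {f = proj₂} (Linked.map (λ {u} {v} → shadow-lazy {u} {v}) walk))
    returns : proj₂ x ∈ proj₂ z ∷ map proj₂ (xs ∷ʳ x)
    returns = there (∈-map⁺ proj₂ (∈-++⁺ʳ xs (here refl)))

  rung-pair-odd : ∀ {x y} → x ∼ y → Odd (pathSum w (closed (x ∷ y ∷ [])))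
  rung-pair-odd {x} {y} x∼y =
    0 , trans (cong (w x y +_) (+-identityʳ _))
              (orientation-weights {G = P2× T} {u = x} {y} (ladder-isOrientation orient) x∼y)

  OddIfCycle : List (Bool × Fin n) → Set
  OddIfCycle C = C ≢ [] → Unique C → Linked _∼_ (closed C) → Odd (pathSum w (closed C))

  hairpin-shortcut : ∀ {x xs} → (∀ C → length C < length (x ∷ xs) → OddIfCycle C) →
                     Unique (x ∷ xs) → Linked _∼_ (closed (x ∷ xs)) → NonBacktracking (closed (x ∷ xs)) →
                     Hairpin proj₂ (closed (x ∷ xs)) → Odd (pathSum w (closed (x ∷ xs)))
  hairpin-shortcut {x} {xs} ih u walk nb
    record { before = before ; after = after ; a = a ; b = b ; split = split ; ends = ends ; middle = middle }
    with ws , C≡ , closed′ ← closed-shortcut before split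
    with walk′ , sum≡ ← square-shortcut before after (subst (Linked _∼_) split walk)
                                        (subst NonBacktracking split nb) ends middle =
    subst Odd (sym weight≡) (odd-double-+ (w a b) odd′)
    where
    C′ = before ++ a ∷ ws
    weight≡ : pathSum w (closed (x ∷ xs)) ≡ 2 * w a b + pathSum w (closed C′)
    weight≡ = trans (cong (pathSum w) split)
                    (trans sum≡ (cong (λ W → 2 * w a b + pathSum w W) (sym closed′)))
    odd′ : Odd (pathSum w (closed C′))
    odd′ = ih C′ (subst (λ C → length C′ < length C) (sym C≡) (length-shortcut before))
              (++-∷-nonempty before) (unique-shortcut before (subst Unique C≡ u))
              (subst (Linked _∼_) (sym closed′) walk′)

  odd-if-cycle : ∀ C → Acc _<_ (length C) → OddIfCycle C
  odd-if-cycle []                _ nonempty _ _         = ⊥-elim (nonempty refl)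
  odd-if-cycle (x ∷ [])          _ _        _ (x∼x ∷ _) = ⊥-elim (adj-irrefl (P2× T) {x} x∼x)
  odd-if-cycle (x ∷ y ∷ [])      _ _        _ (x∼y ∷ _) = rung-pair-odd {x} {y} x∼y
  odd-if-cycle C@(_ ∷ _ ∷ _ ∷ _) (acc shorter) _ u walk with hairpin? Fin._≟_ proj₂ (closed C)
  ... | inj₁ hairpin =
    hairpin-shortcut (λ C′ lt → odd-if-cycle C′ (shorter lt)) u walk (closed-nonBacktracking u) hairpin
  ... | inj₂ free    = ⊥-elim (cycle-shadow-¬hairpinFree u walk free)

  forward-odd : (C : Cycle (P2× T)) → Odd (forwardCount (P2×arc arc) C)
  forward-odd C = tabulated-odd (len≥3 C) (vx-inj C) (vx-adj C)
    where
    tabulated-odd : ∀ {k} {v : Fin k → Bool × Fin n} → 3 ≤ k → (∀ {i j} → v i ≡ v j → i ≡ j) →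
                    (∀ i → v i ∼ v (cnext i)) → Odd (sumFin λ i → w (v i) (v (cnext i)))
    tabulated-odd {suc m} {v} _ inj adjacent = subst Odd (pathSum-closed-tabulate v w)
      (odd-if-cycle (tabulate v) (<-wellFounded _) (λ ()) (tabulate⁺ inj) (linked-closed-tabulate⁺ v adjacent))

  even-cycle-oddly-oriented : (C : Cycle (P2× T)) → Even (len C) → OddlyOriented (P2×arc arc) C
  even-cycle-oddly-oriented C even = forward-odd C ,
    odd-complement (forward-odd C) (subst Even (sym (forward+backward (ladder-isOrientation orient) C)) even)

corollary5 : ∀ (n : ℕ) (T : Graph (Fin n)) → IsTree T →
    ∀ (arc : Fin n → Fin n → Bool) → IsOrientation T arc →
    IsPfaffian (P2× T) (P2×arc arc) ×
    (∀ (C : Cycle (P2× T)) → Even (len C) → OddlyOriented (P2×arc arc) C)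
corollary5 n T (_ , acyclic) arc orient =
  (Ladder.ladder-isOrientation T arc orient , λ C even _ → oddly-oriented C even) , oddly-oriented
  where
  oddly-oriented = even-cycle-oddly-oriented acyclic orient
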